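{- Let $T_1,T_2$ be labeled ordered rooted trees and $k\ge 0$ an integer with $\mathsf{ed}(T_1,T_2)\le k$. Let $(G_1,G_2)$ be a state, with $G_1$ and $G_2$ nonempty, that is reachable from $(T_1,T_2)$ by a directed path of total cost at most $k$ in the DP state transition graph. Then $|\mathsf{size}(LU_{G_1})-\mathsf{size}(LU_{G_2})|\le k$ and $|\mathsf{size}(RU_{G_1})-\mathsf{size}(RU_{G_2})|\le k$, where $LU_{G_i},RU_{G_i}$ are taken in $T_i$.
   Context: Ordered rooted trees and forests: children of each node are linearly ordered, a forest is a linearly ordered sequence of trees; nodes carry labels. Removing a node $v$ from a forest deletes $v$ and puts its children, in order, in the place of $v$. $\mathsf{ed}(F_1,F_2)$ is the minimum number of single-node relabelings and single-node removals applied to $F_1$ and $F_2$ so that the resulting labeled ordered forests are identical. For a nonempty forest $F$: $L_F,R_F$ are its leftmost and rightmost trees, $\ell_F,r_F$ their roots; $L'_F$ is $F$ without $R_F$, $R'_F$ is $F$ without $L_F$; $R^\circ_F$ is $R_F$ with $r_F$ removed, $L^\circ_F$ is $L_F$ with $\ell_F$ removed; $F-v$ is $F$ with $v$ removed; $\mathsf{size}$ counts nodes. A subforest of a tree $T$ is a forest obtained from $T$ by repeatedly removing the leftmost or rightmost root. DP state transition graph: vertices are pairs $(F_1,F_2)$ with $F_i$ a subforest of $T_i$. A state with $F_1$ or $F_2$ empty has no outgoing edges. If both are nonempty and $\mathsf{size}(L_{F_1})>\mathsf{size}(R_{F_1})$, the outgoing edges are: to $(F_1-r_{F_1},F_2)$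 and $(F_1,F_2-r_{F_2})$, each of cost $1$; to $(L'_{F_1},L'_{F_2})$ of cost $|\mathsf{size}(R_{F_1})-\mathsf{size}(R_{F_2})|$; to $(R^\circ_{F_1},R^\circ_{F_2})$ of cost $|\mathsf{size}(L'_{F_1})-\mathsf{size}(L'_{F_2})|$. Otherwise (both nonempty, $\mathsf{size}(L_{F_1})\le\mathsf{size}(R_{F_1})$): to $(F_1-\ell_{F_1},F_2)$ and $(F_1,F_2-\ell_{F_2})$, each of cost $1$; to $(R'_{F_1},R'_{F_2})$ of cost $|\mathsf{size}(L_{F_1})-\mathsf{size}(L_{F_2})|$; to $(L^\circ_{F_1},L^\circ_{F_2})$ of cost $|\mathsf{size}(R'_{F_1})-\mathsf{size}(R'_{F_2})|$. Upper parts: for a nonempty subforest $G$ of a tree $T$, with $\mathsf{pre},\mathsf{post}$ the preorder and postorder indices in $T$ and $\mathsf{LCA}(G)$ the lowest common ancestor in $T$ of the nodes of $G$: $MU_G$ is the set of nodes on the path from the root of $T$ to $\mathsf{LCA}(G)$, including $\mathsf{LCA}(G)$ iff $\mathsf{LCA}(G)\notin G$; $LU_G=\{u\in T\setminus MU_G:\mathsf{pre}(u)<\mathsf{pre}(v)\ \forall v\in G\}$; $RU_G=\{u\in T\setminus MU_G:\mathsf{post}(u)>\mathsf{post}(v)\ \forall v\in G\}$. -}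

module Defs where

open import Data.Nat using (ℕ; zero; suc; _+_; _≤_; _<_; _≡ᵇ_; _<ᵇ_; ∣_-_∣)
open import Data.Bool using (Bool; true; false; if_then_else_; not; _∧_)
open import Data.List using (List; []; _∷_; _++_; length; filter; foldr; map)
open import Data.Bool.ListAction using (any; all)
open import Data.Product using (_×_; _,_; Σ; ∃; ∃-syntax)
open import Relation.Binary.PropositionalEquality using (_≡_)
open import Relation.Nullary.Decidable using (T?)
open import Data.Bool using (T)

data Tree (A : Set) : Set where
  node : A → List (Tree A) → Tree A

Forest : Set → Set
Forest A = List (Tree A)

children : {A : Set} → Tree A → Forest A
children (node _ cs) = cs

mutual
  sizeT : {A : Set} → Tree A → ℕ
  sizeT (node _ cs) = suc (sizeF cs)

  sizeF : {A : Set} → Forest A → ℕ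
  sizeF []       = 0
  sizeF (t ∷ ts) = sizeT t + sizeF ts

data Step {A : Set} : Forest A → Forest A → Set where
  relabel : ∀ a b cs ts → Step (node a cs ∷ ts) (node b cs ∷ ts)
  remove  : ∀ a cs ts   → Step (node a cs ∷ ts) (cs ++ ts)
  down    : ∀ {cs cs'} a ts → Step cs cs' → Step (node a cs ∷ ts) (node a cs' ∷ ts)
  right   : ∀ {ts ts'} t → Step ts ts' → Step (t ∷ ts) (t ∷ ts')

data Steps {A : Set} : Forest A → Forest A → ℕ → Set where
  done : ∀ F → Steps F F 0
  step : ∀ {F F' F'' n} → Step F F' → Steps F' F'' n → Steps F F'' (suc n)

-- ed(F1,F2) ≤ k : there are operation sequences, of total number at most k,
-- applied to F1 and F2, whose results are identical labeled ordered forests.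
EdLe : {A : Set} → Forest A → Forest A → ℕ → Set
EdLe {A} F1 F2 k =
  Σ (Forest A) λ F → ∃[ n1 ] ∃[ n2 ] (Steps F1 F n1 × Steps F2 F n2 × n1 + n2 ≤ k)

-- Node identities: every node of T is annotated with its label and its
-- preorder and postorder indices in T (both starting at 0).

record Info (A : Set) : Set where
  constructor info
  field
    label : A
    pre   : ℕ
    post  : ℕ
open Info public

mutual
  -- arguments: next free preorder index, next free postorder index
  annT : {A : Set} → Tree A → ℕ → ℕ → Tree (Info A) × ℕ × ℕ
  annT (node a cs) p q with annF cs (suc p) q
  ... | cs' , p' , q' = node (info a p q') cs' , p' , suc q'

  annF : {A : Set} → Forest A → ℕ → ℕ → Forest (Info A) × ℕ × ℕ
  annF [] p q = [] , p , q
  annF (t ∷ ts) p q with annT t p q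
  ... | t' , p1 , q1 with annF ts p1 q1
  ...   | ts' , p2 , q2 = t' ∷ ts' , p2 , q2

annotate : {A : Set} → Tree A → Tree (Info A)
annotate t with annT t 0 0
... | t' , _ = t'

module _ {N : Set} where

  lastT : Tree N → Forest N → Tree N
  lastT t []       = t
  lastT t (u ∷ us) = lastT u us

  initT : Tree N → Forest N → Forest N
  initT t []       = []
  initT t (u ∷ us) = t ∷ initT u us

  State : Set
  State = Forest N × Forest N

  data Edge : State → State → ℕ → Set where
    r-del₁ : ∀ t1 ts1 t2 ts2 → sizeT (lastT t1 ts1) < sizeT t1 →
      Edge (t1 ∷ ts1 , t2 ∷ ts2)
           (initT t1 ts1 ++ children (lastT t1 ts1) , t2 ∷ ts2) 1
    r-del₂ : ∀ t1 ts1 t2 ts2 → sizeT (lastT t1 ts1) < sizeT t1 →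
      Edge (t1 ∷ ts1 , t2 ∷ ts2)
           (t1 ∷ ts1 , initT t2 ts2 ++ children (lastT t2 ts2)) 1
    r-rest : ∀ t1 ts1 t2 ts2 → sizeT (lastT t1 ts1) < sizeT t1 →
      Edge (t1 ∷ ts1 , t2 ∷ ts2)
           (initT t1 ts1 , initT t2 ts2)
           ∣ sizeT (lastT t1 ts1) - sizeT (lastT t2 ts2) ∣
    r-in   : ∀ t1 ts1 t2 ts2 → sizeT (lastT t1 ts1) < sizeT t1 →
      Edge (t1 ∷ ts1 , t2 ∷ ts2)
           (children (lastT t1 ts1) , children (lastT t2 ts2))
           ∣ sizeF (initT t1 ts1) - sizeF (initT t2 ts2) ∣
    l-del₁ : ∀ t1 ts1 t2 ts2 → sizeT t1 ≤ sizeT (lastT t1 ts1) →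
      Edge (t1 ∷ ts1 , t2 ∷ ts2) (children t1 ++ ts1 , t2 ∷ ts2) 1
    l-del₂ : ∀ t1 ts1 t2 ts2 → sizeT t1 ≤ sizeT (lastT t1 ts1) →
      Edge (t1 ∷ ts1 , t2 ∷ ts2) (t1 ∷ ts1 , children t2 ++ ts2) 1
    l-rest : ∀ t1 ts1 t2 ts2 → sizeT t1 ≤ sizeT (lastT t1 ts1) →
      Edge (t1 ∷ ts1 , t2 ∷ ts2) (ts1 , ts2) ∣ sizeT t1 - sizeT t2 ∣
    l-in   : ∀ t1 ts1 t2 ts2 → sizeT t1 ≤ sizeT (lastT t1 ts1) →
      Edge (t1 ∷ ts1 , t2 ∷ ts2) (children t1 , children t2)
           ∣ sizeF ts1 - sizeF ts2 ∣

  data Path : State → State → ℕ → Set where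
    here  : ∀ s → Path s s 0
    there : ∀ {s s1 s2 c1 c2} → Edge s s1 c1 → Path s1 s2 c2 → Path s s2 (c1 + c2)

-- Upper parts (nodes identified by their preorder index in T)

module _ {A : Set} where

  mutual
    nodesT : Tree (Info A) → List (Info A)
    nodesT (node i cs) = i ∷ nodesF cs

    nodesF : Forest (Info A) → List (Info A)
    nodesF []       = []
    nodesF (t ∷ ts) = nodesT t ++ nodesF ts

  consNE : ℕ → List ℕ → List ℕ
  consNE x []       = []
  consNE x (y ∷ ys) = x ∷ y ∷ ys

  orElse : List ℕ → List ℕ → List ℕ
  orElse []       q = q
  orElse (x ∷ xs) q = x ∷ xs

  mutual
    -- preorder indices of the nodes on the path from the root of the tree
    -- to the node with preorder index v (inclusive); [] if v is not in it
    pathT : Tree (Info A) → ℕ → List ℕ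
    pathT (node i cs) v =
      if pre i ≡ᵇ v then pre i ∷ [] else consNE (pre i) (pathF cs v)

    pathF : Forest (Info A) → ℕ → List ℕ
    pathF []       v = []
    pathF (t ∷ ts) v = orElse (pathT t v) (pathF ts v)

  lcp : List ℕ → List ℕ → List ℕ
  lcp (x ∷ xs) (y ∷ ys) = if x ≡ᵇ y then x ∷ lcp xs ys else []
  lcp _        _        = []

  -- path from the root of T to LCA(G) (LCA included): the longest common
  -- prefix of the root-paths of all nodes of G
  pathToLCA : Tree (Info A) → Forest (Info A) → List ℕ
  pathToLCA T G with nodesF G
  ... | []     = []
  ... | v ∷ vs = foldr (λ w acc → lcp (pathT T (pre w)) acc) (pathT T (pre v)) vs

  memℕ : ℕ → List ℕ → Bool
  memℕ x xs = any (λ y → x ≡ᵇ y) xs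

  inForest : ℕ → Forest (Info A) → Bool
  inForest x G = any (λ v → x ≡ᵇ pre v) (nodesF G)

  -- drop the last element (the LCA) iff it belongs to G
  dropLastIfIn : Forest (Info A) → List ℕ → List ℕ
  dropLastIfIn G []           = []
  dropLastIfIn G (x ∷ [])     = if inForest x G then [] else x ∷ []
  dropLastIfIn G (x ∷ y ∷ ys) = x ∷ dropLastIfIn G (y ∷ ys)

  MU : Tree (Info A) → Forest (Info A) → List ℕ
  MU T G = dropLastIfIn G (pathToLCA T G)

  LU : Tree (Info A) → Forest (Info A) → List (Info A)
  LU T G = filter (λ u → T? (not (memℕ (pre u) (MU T G))
                             ∧ all (λ v → pre u <ᵇ pre v) (nodesF G)))
                  (nodesT T)

  RU : Tree (Info A) → Forest (Info A) → List (Info A)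
  RU T G = filter (λ u → T? (not (memℕ (pre u) (MU T G))
                             ∧ all (λ v → post v <ᵇ post u) (nodesF G)))
                  (nodesT T)

-- Every forest G on a DP path from (T) is a
-- left-to-right sequence of whole subtrees of T whose preorder indices lie in a window [pa, ea)
-- and whose postorder indices lie in [pb, eb) (a Chain).  Every node with postorder index below
-- pb is in LU_G, and LU_G and G both lie below eb, so pb ≤ |LU_G| ≤ eb − |G|; dually, with
-- preorder indices, n − ea ≤ |RU_G| ≤ n − pa − |G|.  Along the path we keep numbers l ≤ pb and
-- eb ≤ l + dl + |G|, and r, dr for the right side (an Invariant): deleting a root raises a slack
-- dl or dr by one, and an edge discarding subforests of sizes s₁, s₂ adds them to l₁, l₂ (or to
-- r₁, r₂).  As ∣(l₁ + s₁) − (l₂ + s₂)∣ ≤ ∣l₁ − l₂∣ + ∣s₁ − s₂∣, the edge costs keep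
-- ∣l₁ − l₂∣ + dl₁ + dl₂ and ∣r₁ − r₂∣ + dr₁ + dr₂ below the path cost c ≤ k, and the bounds on
-- |LU| and |RU| give the claim.

{-# OPTIONS --safe #-}
module Submission where

open import Defs
open import Data.Bool using (Bool; true; false; not; _∧_; T)
open import Data.Bool.ListAction using (all)
open import Data.Empty using (⊥-elim)
open import Data.List using (List; []; _∷_; _++_; length; filter; foldr)
open import Data.List.Properties using (length-++; filter-++; ++-assoc; ++-identityʳ)
open import Data.List.Membership.Propositional using (_∈_; find)
open import Data.List.Membership.Propositional.Properties using (∈-++⁺ˡ; ∈-++⁺ʳ; ∈-++⁻)
open import Data.List.Relation.Unary.All as All using (All; []; _∷_)
open import Data.List.Relation.Unary.All.Properties using (all⁺; all⁻)
open import Data.List.Relation.Unary.Any as Any using (Any; here; there)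
open import Data.List.Relation.Unary.Any.Properties using (any⁺; any⁻; ¬Any[])
open import Data.List.Relation.Binary.Sublist.Propositional
  using (_⊆_; []; _∷_; _∷ʳ_; minimum; ⊆-refl; ⊆-reflexive; ⊆-trans; lookup)
open import Data.List.Relation.Binary.Sublist.Propositional.Properties using (∷ˡ⁻; ++⁺ˡ; ++⁺ʳ; ++⁺)
open import Data.Nat.Tactic.RingSolver using (solve-∀)
open import Data.Nat
  using (ℕ; zero; suc; _+_; _∸_; _⊓_; _≤_; _<_; _≡ᵇ_; _<ᵇ_; ∣_-_∣; z≤n; s≤s; z<s; _<?_; _≤?_)
open import Data.Nat.Properties
open import Data.Product using (_×_; _,_; ∃-syntax; proj₁; proj₂)
open import Data.Sum as Sum using (_⊎_; inj₁; inj₂)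
open import Function using (_∘_; id)
open import Relation.Binary.PropositionalEquality
open import Relation.Nullary using (¬_; yes; no)
open import Relation.Nullary.Decidable using (T?)

module _ {X : Set} where

  count : (X → Bool) → List X → ℕ
  count f xs = length (filter (T? ∘ f) xs)

  count-++ : (f : X → Bool) (xs ys : List X) → count f (xs ++ ys) ≡ count f xs + count f ys
  count-++ f xs ys = trans (cong length (filter-++ (T? ∘ f) xs ys)) (length-++ (filter (T? ∘ f) xs))

  count+count-not : (f : X → Bool) (xs : List X) → count f xs + count (not ∘ f) xs ≡ length xs
  count+count-not f [] = refl
  count+count-not f (x ∷ xs) with f x
  ... | true  = cong suc (count+count-not f xs)
  ... | false = trans (+-suc _ _) (cong suc (count+count-not f xs))

  count+length≤count : (f g : X → Bool) {ys xs : List X} → ys ⊆ xs →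
    All (λ y → T (g y) × ¬ T (f y)) ys → (∀ {x} → x ∈ xs → T (f x) → T (g x)) →
    count f xs + length ys ≤ count g xs
  count+length≤count f g [] [] f⇒g = z≤n
  count+length≤count f g (x ∷ʳ ys⊆xs) gys f⇒g with f x in fx | g x in gx
  ... | true  | true  = s≤s (count+length≤count f g ys⊆xs gys (f⇒g ∘ there))
  ... | true  | false = ⊥-elim (subst T gx (f⇒g (here refl) (subst T (sym fx) _)))
  ... | false | true  = m≤n⇒m≤1+n (count+length≤count f g ys⊆xs gys (f⇒g ∘ there))
  ... | false | false = count+length≤count f g ys⊆xs gys (f⇒g ∘ there)
  count+length≤count f g (_∷_ {x} {xs = ys} {ys = xs} refl ys⊆xs) ((gx , ¬fx) ∷ gys) f⇒g
    with f x | g x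
  ... | true  | _     = ⊥-elim (¬fx _)
  ... | false | false = ⊥-elim gx
  ... | false | true  = ≤-trans (≤-reflexive (+-suc (count f xs) (length ys)))
                          (s≤s (count+length≤count f g ys⊆xs gys (f⇒g ∘ there)))

  count-mono : (f g : X → Bool) (xs : List X) → (∀ {x} → x ∈ xs → T (f x) → T (g x)) →
    count f xs ≤ count g xs
  count-mono f g xs f⇒g =
    subst (_≤ count g xs) (+-identityʳ _) (count+length≤count f g (minimum xs) [] f⇒g)

⊓-+-split : ∀ x s S → x ⊓ s + (x ∸ s) ⊓ S ≡ x ⊓ (s + S)
⊓-+-split zero    s       S rewrite 0∸n≡0 s = refl
⊓-+-split (suc x) zero    S = refl
⊓-+-split (suc x) (suc s) S = cong suc (⊓-+-split x s S)

sizeF-++ : ∀ {X : Set} (xs ys : Forest X) → sizeF (xs ++ ys) ≡ sizeF xs + sizeF ys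
sizeF-++ []       ys = refl
sizeF-++ (x ∷ xs) ys = trans (cong (sizeT x +_) (sizeF-++ xs ys)) (sym (+-assoc (sizeT x) _ _))

init-last : ∀ {N} (t : Tree N) ts → t ∷ ts ≡ initT t ts ++ lastT t ts ∷ []
init-last t []       = refl
init-last t (u ∷ us) = cong (t ∷_) (init-last u us)

T-not∧⁺ : ∀ {b c} → ¬ T b → T c → T (not b ∧ c)
T-not∧⁺ {false} {true} _  _ = _
T-not∧⁺ {true}         ¬b _ = ¬b _

T-not∧⁻ : ∀ {b c} → T (not b ∧ c) → ¬ T b × T c
T-not∧⁻ {false} {true} _ = (λ ()) , _

T-not⁺ : ∀ {b} → ¬ T b → T (not b)
T-not⁺ {false} _  = _
T-not⁺ {true}  ¬b = ¬b _

T-not⁻ : ∀ {b} → T (not b) → ¬ T b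
T-not⁻ {false} _ ()

≡ᵇ-true⇒≡ : ∀ {m n} → (m ≡ᵇ n) ≡ true → m ≡ n
≡ᵇ-true⇒≡ {m} {n} eq = ≡ᵇ⇒≡ m n (subst T (sym eq) _)

≡ᵇ-false⇒≢ : ∀ {m n} → (m ≡ᵇ n) ≡ false → m ≢ n
≡ᵇ-false⇒≢ {m} eq refl = subst T eq (≡⇒≡ᵇ m m refl)

module _ {A : Set} where

  data NumberedT : Tree (Info A) → ℕ → ℕ → Set
  data NumberedF : Forest (Info A) → ℕ → ℕ → Set

  data NumberedT where
    node : ∀ {a p q cs} → NumberedF cs (suc p) q → NumberedT (node (info a p (q + sizeF cs)) cs) p q

  data NumberedF where
    []  : ∀ {p q} → NumberedF [] p q
    _∷_ : ∀ {t ts p q} → NumberedT t p q → NumberedF ts (p + sizeT t) (q + sizeT t) →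
          NumberedF (t ∷ ts) p q

  NumberingT : Tree (Info A) × ℕ × ℕ → ℕ → ℕ → Set
  NumberingT (t , p′ , q′) p q = NumberedT t p q × p′ ≡ p + sizeT t × q′ ≡ q + sizeT t

  NumberingF : Forest (Info A) × ℕ × ℕ → ℕ → ℕ → Set
  NumberingF (ts , p′ , q′) p q = NumberedF ts p q × p′ ≡ p + sizeF ts × q′ ≡ q + sizeF ts

  annT-numbering : (t : Tree A) (p q : ℕ) → NumberingT (annT t p q) p q
  annF-numbering : (ts : Forest A) (p q : ℕ) → NumberingF (annF ts p q) p q
  annT-numbering (node a cs) p q with annF cs (suc p) q | annF-numbering cs (suc p) q
  ... | cs′ , _ , _ | num , refl , refl = node num , sym (+-suc p _) , sym (+-suc q _)
  annF-numbering []       p q = [] , sym (+-identityʳ p) , sym (+-identityʳ q)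
  annF-numbering (t ∷ ts) p q with annT t p q | annT-numbering t p q
  ... | t′ , _ , _ | num , refl , refl
    with annF ts (p + sizeT t′) (q + sizeT t′) | annF-numbering ts (p + sizeT t′) (q + sizeT t′)
  ... | ts′ , _ , _ | nums , refl , refl = num ∷ nums , +-assoc p _ _ , +-assoc q _ _

  annotate-numbered : (t : Tree A) → NumberedT (annotate t) 0 0
  annotate-numbered t with annT t 0 0 | annT-numbering t 0 0
  ... | _ , _ | num , _ = num

  nodesF-++ : (xs ys : Forest (Info A)) → nodesF (xs ++ ys) ≡ nodesF xs ++ nodesF ys
  nodesF-++ []       ys = refl
  nodesF-++ (x ∷ xs) ys = trans (cong (nodesT x ++_) (nodesF-++ xs ys)) (sym (++-assoc (nodesT x) _ _))

  length-nodesT : (t : Tree (Info A)) → length (nodesT t) ≡ sizeT t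
  length-nodesF : (ts : Forest (Info A)) → length (nodesF ts) ≡ sizeF ts
  length-nodesT (node _ cs) = cong suc (length-nodesF cs)
  length-nodesF []       = refl
  length-nodesF (t ∷ ts) = trans (length-++ (nodesT t)) (cong₂ _+_ (length-nodesT t) (length-nodesF ts))

  record InWindow (u : Info A) (pa pb ea eb : ℕ) : Set where
    constructor window
    field
      pre≥  : pa ≤ pre u
      pre<  : pre u < ea
      post≥ : pb ≤ post u
      post< : post u < eb
  open InWindow public

  window-weaken : ∀ {u pa pb ea eb pa′ pb′ ea′ eb′} → pa′ ≤ pa → pb′ ≤ pb → ea ≤ ea′ → eb ≤ eb′ →
    InWindow u pa pb ea eb → InWindow u pa′ pb′ ea′ eb′
  window-weaken a b c d (window e f g h) =
    window (≤-trans a e) (<-≤-trans f c) (≤-trans b g) (<-≤-trans h d)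

  windowT : ∀ {t p q u} → NumberedT t p q → u ∈ nodesT t → InWindow u p q (p + sizeT t) (q + sizeT t)
  windowF : ∀ {ts p q u} → NumberedF ts p q → u ∈ nodesF ts →
    InWindow u p q (p + sizeF ts) (q + sizeF ts)
  windowT {p = p} {q} (node {cs = cs} _) (here refl) =
    window ≤-refl (m<m+n p z<s) (m≤m+n q _) (≤-reflexive (sym (+-suc q (sizeF cs))))
  windowT {p = p} {q} (node {cs = cs} num) (there u∈cs) =
    window-weaken (n≤1+n p) ≤-refl (≤-reflexive (sym (+-suc p (sizeF cs))))
      (+-monoʳ-≤ q (n≤1+n (sizeF cs))) (windowF num u∈cs)
  windowF {t ∷ ts} {p} {q} (num ∷ nums) u∈ with ∈-++⁻ (nodesT t) u∈
  ... | inj₁ u∈t  = window-weaken ≤-refl ≤-refl (+-monoʳ-≤ p (m≤m+n _ _)) (+-monoʳ-≤ q (m≤m+n _ _))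
                      (windowT num u∈t)
  ... | inj₂ u∈ts = window-weaken (m≤m+n p _) (m≤m+n q _) (≤-reflexive (+-assoc p _ _))
                      (≤-reflexive (+-assoc q _ _)) (windowF nums u∈ts)

  count-pre<-T : ∀ {t p q} → NumberedT t p q → ∀ m →
    count (λ u → pre u <ᵇ m) (nodesT t) ≡ (m ∸ p) ⊓ sizeT t
  count-pre<-F : ∀ {ts p q} → NumberedF ts p q → ∀ m →
    count (λ u → pre u <ᵇ m) (nodesF ts) ≡ (m ∸ p) ⊓ sizeF ts
  count-pre<-T {p = p} (node {cs = cs} num) m with p <ᵇ m in p<ᵇm
  count-pre<-T {p = p} (node {cs = cs} num) (suc m) | true =
    trans (cong suc (count-pre<-F num (suc m))) (cong (_⊓ suc (sizeF cs)) (sym (+-∸-assoc 1 p≤m)))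
    where p≤m = ≤-pred (<ᵇ⇒< p (suc m) (subst T (sym p<ᵇm) _))
  ... | false = begin
    count (λ u → pre u <ᵇ m) (nodesF cs) ≡⟨ count-pre<-F num m ⟩
    (m ∸ suc p) ⊓ sizeF cs              ≡⟨ cong (_⊓ sizeF cs) (m≤n⇒m∸n≡0 (m≤n⇒m≤1+n m≤p)) ⟩
    0                                    ≡⟨ cong (_⊓ suc (sizeF cs)) (m≤n⇒m∸n≡0 m≤p) ⟨
    (m ∸ p) ⊓ suc (sizeF cs)            ∎
    where open ≡-Reasoning
          m≤p = ≮⇒≥ {p} {m} (subst T p<ᵇm ∘ <⇒<ᵇ)
  count-pre<-F [] m = sym (⊓-zeroʳ _)
  count-pre<-F {t ∷ ts} {p} (num ∷ nums) m = begin
    count f (nodesT t ++ nodesF ts)              ≡⟨ count-++ f (nodesT t) (nodesF ts) ⟩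
    count f (nodesT t) + count f (nodesF ts)
      ≡⟨ cong₂ _+_ (count-pre<-T num m) (count-pre<-F nums m) ⟩
    (m ∸ p) ⊓ sizeT t + (m ∸ (p + sizeT t)) ⊓ sizeF ts
      ≡⟨ cong (λ x → (m ∸ p) ⊓ sizeT t + x ⊓ sizeF ts) (sym (∸-+-assoc m p (sizeT t))) ⟩
    (m ∸ p) ⊓ sizeT t + (m ∸ p ∸ sizeT t) ⊓ sizeF ts ≡⟨ ⊓-+-split (m ∸ p) (sizeT t) (sizeF ts) ⟩
    (m ∸ p) ⊓ (sizeT t + sizeF ts)               ∎
    where open ≡-Reasoning
          f = λ (u : Info A) → pre u <ᵇ m

  count-post<-T : ∀ {t p q} → NumberedT t p q → ∀ m →
    count (λ u → post u <ᵇ m) (nodesT t) ≡ (m ∸ q) ⊓ sizeT t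
  count-post<-F : ∀ {ts p q} → NumberedF ts p q → ∀ m →
    count (λ u → post u <ᵇ m) (nodesF ts) ≡ (m ∸ q) ⊓ sizeF ts
  count-post<-T {q = q} (node {cs = cs} num) m with q + sizeF cs <ᵇ m in root<ᵇm
  ... | true = begin
    suc (count (λ u → post u <ᵇ m) (nodesF cs)) ≡⟨ cong suc (count-post<-F num m) ⟩
    suc ((m ∸ q) ⊓ S)                            ≡⟨ cong suc (m≥n⇒m⊓n≡n (<⇒≤ S<m∸q)) ⟩
    suc S                                        ≡⟨ m≥n⇒m⊓n≡n S<m∸q ⟨
    (m ∸ q) ⊓ suc S                              ∎
    where open ≡-Reasoning
          S = sizeF cs
          S<m∸q : S < m ∸ q
          S<m∸q = subst (_< m ∸ q) (m+n∸m≡n q S)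
                    (∸-monoˡ-< (<ᵇ⇒< _ m (subst T (sym root<ᵇm) _)) (m≤m+n q S))
  ... | false = begin
    count (λ u → post u <ᵇ m) (nodesF cs) ≡⟨ count-post<-F num m ⟩
    (m ∸ q) ⊓ S                           ≡⟨ m≤n⇒m⊓n≡m m∸q≤S ⟩
    m ∸ q                                 ≡⟨ m≤n⇒m⊓n≡m (m≤n⇒m≤1+n m∸q≤S) ⟨
    (m ∸ q) ⊓ suc S                       ∎
    where open ≡-Reasoning
          S = sizeF cs
          m∸q≤S : m ∸ q ≤ S
          m∸q≤S = subst (m ∸ q ≤_) (m+n∸m≡n q S)
                    (∸-monoˡ-≤ q (≮⇒≥ (subst T root<ᵇm ∘ <⇒<ᵇ)))
  count-post<-F [] m = sym (⊓-zeroʳ _)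
  count-post<-F {t ∷ ts} {q = q} (num ∷ nums) m = begin
    count f (nodesT t ++ nodesF ts)              ≡⟨ count-++ f (nodesT t) (nodesF ts) ⟩
    count f (nodesT t) + count f (nodesF ts)
      ≡⟨ cong₂ _+_ (count-post<-T num m) (count-post<-F nums m) ⟩
    (m ∸ q) ⊓ sizeT t + (m ∸ (q + sizeT t)) ⊓ sizeF ts
      ≡⟨ cong (λ x → (m ∸ q) ⊓ sizeT t + x ⊓ sizeF ts) (sym (∸-+-assoc m q (sizeT t))) ⟩
    (m ∸ q) ⊓ sizeT t + (m ∸ q ∸ sizeT t) ⊓ sizeF ts ≡⟨ ⊓-+-split (m ∸ q) (sizeT t) (sizeF ts) ⟩
    (m ∸ q) ⊓ (sizeT t + sizeF ts)               ∎
    where open ≡-Reasoning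
          f = λ (u : Info A) → post u <ᵇ m

  root : Tree (Info A) → Info A
  root (node i _) = i

  infix 4 _≼_
  record _≼_ (u v : Info A) : Set where
    constructor _,_
    field
      pre-≤  : pre u ≤ pre v
      post-≥ : post v ≤ post u
  open _≼_ public

  ≼-trans : ∀ {u v w} → u ≼ v → v ≼ w → u ≼ w
  ≼-trans (a , b) (c , d) = ≤-trans a c , ≤-trans d b

  root-≼ : ∀ {t p q v} → NumberedT t p q → v ∈ nodesT t → root t ≼ v
  root-≼ {q = q} num@(node _) v∈t with windowT num v∈t
  ... | window a _ _ d = a , ≤-pred (<-≤-trans d (≤-reflexive (+-suc q _)))

  ∈-children : ∀ {i cs p q u} → NumberedT (node i cs) p q → u ∈ nodesT (node i cs) →
    pre u ≢ p → u ∈ nodesF cs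
  ∈-children (node _) (here refl) u≢root = ⊥-elim (u≢root refl)
  ∈-children (node _) (there u∈cs)  _     = u∈cs

  ∈-childrenᵇ : ∀ {i cs p q u} → NumberedT (node i cs) p q → u ∈ nodesT (node i cs) →
    (p ≡ᵇ pre u) ≡ false → u ∈ nodesF cs
  ∈-childrenᵇ num u∈ p≢ᵇu = ∈-children num u∈ (≢-sym (≡ᵇ-false⇒≢ p≢ᵇu))

  ≡root : ∀ {t p q u} → NumberedT t p q → u ∈ nodesT t → pre u ≡ p → u ≡ root t
  ≡root (node _)   (here refl)  _  = refl
  ≡root (node num) (there u∈cs) eq = ⊥-elim (<-irrefl (sym eq) (pre≥ (windowF num u∈cs)))

  ∈-head : ∀ {t ts p q u} → NumberedF ts (p + sizeT t) (q + sizeT t) →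
    u ∈ nodesT t ++ nodesF ts → pre u < p + sizeT t → u ∈ nodesT t
  ∈-head {t} nums u∈ lt with ∈-++⁻ (nodesT t) u∈
  ... | inj₁ u∈t  = u∈t
  ... | inj₂ u∈ts = ⊥-elim (<⇒≱ lt (pre≥ (windowF nums u∈ts)))

  ∈-head-post : ∀ {t ts p q u} → NumberedF ts (p + sizeT t) (q + sizeT t) →
    u ∈ nodesT t ++ nodesF ts → post u < q + sizeT t → u ∈ nodesT t
  ∈-head-post {t} nums u∈ lt with ∈-++⁻ (nodesT t) u∈
  ... | inj₁ u∈t  = u∈t
  ... | inj₂ u∈ts = ⊥-elim (<⇒≱ lt (post≥ (windowF nums u∈ts)))

  ∈-tail : ∀ {t ts p q u} → NumberedT t p q →
    u ∈ nodesT t ++ nodesF ts → p + sizeT t ≤ pre u → u ∈ nodesF ts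
  ∈-tail {t} num u∈ le with ∈-++⁻ (nodesT t) u∈
  ... | inj₁ u∈t  = ⊥-elim (<⇒≱ (pre< (windowT num u∈t)) le)
  ... | inj₂ u∈ts = u∈ts

  ∈-consNE⁻ : ∀ {x p L} → x ∈ consNE {A} p L → x ≡ p ⊎ x ∈ L
  ∈-consNE⁻ {L = _ ∷ _} (here refl) = inj₁ refl
  ∈-consNE⁻ {L = _ ∷ _} (there x∈L) = inj₂ x∈L

  consNE-nonempty : ∀ {x p L} → x ∈ L → consNE {A} p L ≡ p ∷ L
  consNE-nonempty {L = _ ∷ _} _ = refl

  ∈-orElse⁻ : ∀ {x P Q} → x ∈ orElse {A} P Q → x ∈ P ⊎ x ∈ Q
  ∈-orElse⁻ {P = []}    x∈Q = inj₂ x∈Q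
  ∈-orElse⁻ {P = _ ∷ _} x∈P = inj₁ x∈P

  orElse-nonempty : ∀ {x P Q} → x ∈ P → orElse {A} P Q ≡ P
  orElse-nonempty {P = _ ∷ _} _ = refl

  pathT-outside : ∀ {t p q y} → NumberedT t p q → y < p ⊎ p + sizeT t ≤ y → pathT t y ≡ []
  pathF-outside : ∀ {ts p q y} → NumberedF ts p q → y < p ⊎ p + sizeF ts ≤ y → pathF ts y ≡ []
  pathT-outside {p = p} {y = y} (node num) out with p ≡ᵇ y in p≡ᵇy
  ... | true with ≡ᵇ-true⇒≡ {p} {y} p≡ᵇy | out
  ...   | refl | inj₁ y<y   = ⊥-elim (<-irrefl refl y<y)
  ...   | refl | inj₂ y+s≤y = ⊥-elim (<⇒≱ (m<m+n p z<s) y+s≤y)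
  pathT-outside {p = p} {y = y} (node num) out | false
    rewrite pathF-outside num (Sum.map m≤n⇒m≤1+n (≤-trans (≤-reflexive (sym (+-suc p _)))) out) = refl
  pathF-outside []           out = refl
  pathF-outside {t ∷ ts} {p} (num ∷ nums) out
    rewrite pathT-outside num (Sum.map id (≤-trans (+-monoʳ-≤ p (m≤m+n _ _))) out)
          | pathF-outside nums (Sum.map (λ y<p → <-≤-trans y<p (m≤m+n p _))
                                             (≤-trans (≤-reflexive (+-assoc p _ _))) out)
    = refl

  nonempty⇒inside : ∀ {p s y x} {L : List ℕ} → (y < p ⊎ p + s ≤ y → L ≡ []) → x ∈ L →
    p ≤ y × y < p + s
  nonempty⇒inside {p} {s} {y} outside⇒[] x∈L with y <? p | p + s ≤? y
  ... | yes y<p | _         = ⊥-elim (¬Any[] (subst (_ ∈_) (outside⇒[] (inj₁ y<p)) x∈L))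
  ... | no _    | yes p+s≤y = ⊥-elim (¬Any[] (subst (_ ∈_) (outside⇒[] (inj₂ p+s≤y)) x∈L))
  ... | no y≮p  | no p+s≰y  = ≮⇒≥ y≮p , ≰⇒> p+s≰y

  ∈-consNE⁺ : ∀ {x p L} → x ∈ L → x ∈ consNE {A} p L
  ∈-consNE⁺ {L = _ ∷ _} x∈L = there x∈L

  pathT-target-bounds : ∀ {t p q y x} → NumberedT t p q → x ∈ pathT t y → p ≤ y × y < p + sizeT t
  pathT-target-bounds num = nonempty⇒inside (pathT-outside num)

  pathF-target-bounds : ∀ {ts p q y x} → NumberedF ts p q → x ∈ pathF ts y → p ≤ y × y < p + sizeF ts
  pathF-target-bounds nums = nonempty⇒inside (pathF-outside nums)

  pathT-entry-bounds : ∀ {t p q y x} → NumberedT t p q → x ∈ pathT t y → p ≤ x × x < p + sizeT t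
  pathF-entry-bounds : ∀ {ts p q y x} → NumberedF ts p q → x ∈ pathF ts y → p ≤ x × x < p + sizeF ts
  pathT-entry-bounds {p = p} {y = y} (node num) x∈ with p ≡ᵇ y
  ... | true with x∈
  ...   | here refl = ≤-refl , m<m+n p z<s
  pathT-entry-bounds {p = p} {y = y} (node num) x∈ | false with ∈-consNE⁻ x∈
  ...   | inj₁ refl = ≤-refl , m<m+n p z<s
  ...   | inj₂ x∈cs with pathF-entry-bounds num x∈cs
  ...     | l , u = <⇒≤ l , <-≤-trans u (≤-reflexive (sym (+-suc p _)))
  pathF-entry-bounds {t ∷ ts} {p} (num ∷ nums) x∈ with ∈-orElse⁻ x∈
  ... | inj₁ x∈t with pathT-entry-bounds num x∈t
  ...   | l , u = l , <-≤-trans u (+-monoʳ-≤ p (m≤m+n _ _))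
  pathF-entry-bounds {t ∷ ts} {p} (num ∷ nums) x∈ | inj₂ x∈ts with pathF-entry-bounds nums x∈ts
  ...   | l , u = m+n≤o⇒m≤o p l , <-≤-trans u (≤-reflexive (+-assoc p _ _))

  pre∈pathT : ∀ {t p q u} → NumberedT t p q → u ∈ nodesT t → pre u ∈ pathT t (pre u)
  pre∈pathF : ∀ {ts p q u} → NumberedF ts p q → u ∈ nodesF ts → pre u ∈ pathF ts (pre u)
  pre∈pathT {p = p} {u = u} (node num) u∈ with p ≡ᵇ pre u in p≡ᵇu
  ... | true  = here (sym (≡ᵇ-true⇒≡ p≡ᵇu))
  ... | false = ∈-consNE⁺ (pre∈pathF num (∈-childrenᵇ (node num) u∈ p≡ᵇu))
  pre∈pathF {t ∷ ts} {u = u} (num ∷ nums) u∈ with ∈-++⁻ (nodesT t) u∈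
  ... | inj₁ u∈t  = subst (pre u ∈_) (sym (orElse-nonempty u∈path)) u∈path
    where u∈path = pre∈pathT num u∈t
  ... | inj₂ u∈ts rewrite pathT-outside num (inj₂ (pre≥ (windowF nums u∈ts))) = pre∈pathF nums u∈ts

  pathT⇒≼ : ∀ {t p q u v} → NumberedT t p q → u ∈ nodesT t → v ∈ nodesT t →
    pre u ∈ pathT t (pre v) → u ≼ v
  pathF⇒≼ : ∀ {ts p q u v} → NumberedF ts p q → u ∈ nodesF ts → v ∈ nodesF ts →
    pre u ∈ pathF ts (pre v) → u ≼ v
  pathT⇒≼ {p = p} {v = v} (node num) u∈ v∈ u∈path with p ≡ᵇ pre v
  ... | true with u∈path
  ...   | here u≡p = subst (_≼ v) (sym (≡root (node num) u∈ u≡p)) (root-≼ (node num) v∈)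
  pathT⇒≼ {p = p} {v = v} (node num) u∈ v∈ u∈path | false with ∈-consNE⁻ u∈path
  ...   | inj₁ u≡p  = subst (_≼ v) (sym (≡root (node num) u∈ u≡p)) (root-≼ (node num) v∈)
  ...   | inj₂ u∈cs =
          pathF⇒≼ num (∈-children (node num) u∈ (>⇒≢ (proj₁ (pathF-entry-bounds num u∈cs))))
                      (∈-children (node num) v∈ (>⇒≢ (proj₁ (pathF-target-bounds num u∈cs)))) u∈cs
  pathF⇒≼ {t ∷ ts} (num ∷ nums) u∈ v∈ u∈path with ∈-orElse⁻ u∈path
  ... | inj₁ u∈t  = pathT⇒≼ num (∈-head nums u∈ (proj₂ (pathT-entry-bounds num u∈t)))
                                (∈-head nums v∈ (proj₂ (pathT-target-bounds num u∈t))) u∈t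
  ... | inj₂ u∈ts = pathF⇒≼ nums (∈-tail {ts = ts} num u∈ (proj₁ (pathF-entry-bounds nums u∈ts)))
                                 (∈-tail {ts = ts} num v∈ (proj₁ (pathF-target-bounds nums u∈ts))) u∈ts

  ≼⇒pathT-prefix : ∀ {t p q u v} → NumberedT t p q → u ∈ nodesT t → v ∈ nodesT t → u ≼ v →
    ∃[ r ] pathT t (pre v) ≡ pathT t (pre u) ++ r
  ≼⇒pathF-prefix : ∀ {ts p q u v} → NumberedF ts p q → u ∈ nodesF ts → v ∈ nodesF ts → u ≼ v →
    ∃[ r ] pathF ts (pre v) ≡ pathF ts (pre u) ++ r
  ≼⇒pathT-prefix {node i cs} {p} {u = u} {v} (node num) u∈ v∈ u≼v
    with p ≡ᵇ pre u in p≡ᵇu | p ≡ᵇ pre v in p≡ᵇv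
  ... | true  | true  = [] , refl
  ... | true  | false =
    pathF cs (pre v) , consNE-nonempty (pre∈pathF num (∈-childrenᵇ (node num) v∈ p≡ᵇv))
  ... | false | true  = ⊥-elim (<⇒≱ (pre≥ (windowF num (∈-childrenᵇ (node num) u∈ p≡ᵇu)))
                                     (subst (pre u ≤_) (sym (≡ᵇ-true⇒≡ p≡ᵇv)) (pre-≤ u≼v)))
  ... | false | false
    with ≼⇒pathF-prefix num (∈-childrenᵇ (node num) u∈ p≡ᵇu) (∈-childrenᵇ (node num) v∈ p≡ᵇv) u≼v
  ...   | r , eq = r , (begin
    consNE {A} p (pathF cs (pre v))      ≡⟨ cong (consNE {A} p) eq ⟩
    consNE {A} p (pathF cs (pre u) ++ r) ≡⟨ consNE-nonempty (∈-++⁺ˡ u∈path) ⟩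
    p ∷ pathF cs (pre u) ++ r            ≡⟨ cong (_++ r) (consNE-nonempty u∈path) ⟨
    consNE {A} p (pathF cs (pre u)) ++ r ∎)
    where open ≡-Reasoning
          u∈path = pre∈pathF num (∈-childrenᵇ (node num) u∈ p≡ᵇu)
  ≼⇒pathF-prefix {t ∷ ts} {p} {q} {u} {v} (num ∷ nums) u∈ v∈ u≼v with ∈-++⁻ (nodesT t) u∈
  ... | inj₁ u∈t with ∈-head-post nums v∈ (≤-<-trans (post-≥ u≼v) (post< (windowT num u∈t)))
  ...   | v∈t with ≼⇒pathT-prefix num u∈t v∈t u≼v
  ...     | r , eq = r , (begin
    orElse {A} (pathT t (pre v)) (pathF ts (pre v)) ≡⟨ orElse-nonempty (pre∈pathT num v∈t) ⟩
    pathT t (pre v)                             ≡⟨ eq ⟩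
    pathT t (pre u) ++ r                        ≡⟨ cong (_++ r) (orElse-nonempty (pre∈pathT num u∈t)) ⟨
    orElse {A} (pathT t (pre u)) (pathF ts (pre u)) ++ r ∎)
    where open ≡-Reasoning
  ≼⇒pathF-prefix {t ∷ ts} {p} {q} {u} {v} (num ∷ nums) u∈ v∈ u≼v | inj₂ u∈ts
    with ∈-tail {ts = ts} num v∈ (≤-trans (pre≥ (windowF nums u∈ts)) (pre-≤ u≼v))
  ... | v∈ts rewrite pathT-outside num (inj₂ (pre≥ (windowF nums v∈ts)))
                   | pathT-outside num (inj₂ (pre≥ (windowF nums u∈ts)))
                   = ≼⇒pathF-prefix nums u∈ts v∈ts u≼v

  data Subtree (s : Tree (Info A)) : Tree (Info A) → Set where
    self  : Subtree s s
    below : ∀ {i cs} → Any (Subtree s) cs → Subtree s (node i cs)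

  Subtree-trans : ∀ {s t u} → Subtree s t → Subtree t u → Subtree s u
  Subtree-trans-Any : ∀ {s t us} → Subtree s t → Any (Subtree t) us → Any (Subtree s) us
  Subtree-trans s⊑t self         = s⊑t
  Subtree-trans s⊑t (below t⊑cs) = below (Subtree-trans-Any s⊑t t⊑cs)
  Subtree-trans-Any s⊑t (here t⊑u)   = here (Subtree-trans s⊑t t⊑u)
  Subtree-trans-Any s⊑t (there t⊑us) = there (Subtree-trans-Any s⊑t t⊑us)

  children-Subtree : ∀ {i cs Tr} → Subtree (node i cs) Tr → ∀ {c} → c ∈ cs → Subtree c Tr
  children-Subtree st c∈ = Subtree-trans (below (Any.map (λ { refl → self }) c∈)) st

  root∈subtreeT : ∀ {s t} → Subtree s t → root s ∈ nodesT t
  root∈subtreeF : ∀ {s ts} → Any (Subtree s) ts → root s ∈ nodesF ts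
  root∈subtreeT {node i cs} self = here refl
  root∈subtreeT (below s⊑cs)     = there (root∈subtreeF s⊑cs)
  root∈subtreeF (here s⊑t)             = ∈-++⁺ˡ (root∈subtreeT s⊑t)
  root∈subtreeF {ts = t ∷ _} (there s⊑ts) = ∈-++⁺ʳ (nodesT t) (root∈subtreeF s⊑ts)

  root≼⇒∈subtreeT : ∀ {s t p q u} → Subtree s t → NumberedT t p q → u ∈ nodesT t →
    root s ≼ u → u ∈ nodesT s
  root≼⇒∈subtreeF : ∀ {s ts p q u} → Any (Subtree s) ts → NumberedF ts p q → u ∈ nodesF ts →
    root s ≼ u → u ∈ nodesT s
  root≼⇒∈subtreeT self num u∈ _ = u∈
  root≼⇒∈subtreeT (below s⊑cs) (node num) u∈ s≼u =
    root≼⇒∈subtreeF s⊑cs num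
      (∈-children (node num) u∈ (>⇒≢ (<-≤-trans (pre≥ (windowF num (root∈subtreeF s⊑cs))) (pre-≤ s≼u))))
      s≼u
  root≼⇒∈subtreeF (here s⊑t) (num ∷ nums) u∈ s≼u =
    root≼⇒∈subtreeT s⊑t num
      (∈-head-post nums u∈ (≤-<-trans (post-≥ s≼u) (post< (windowT num (root∈subtreeT s⊑t))))) s≼u
  root≼⇒∈subtreeF {ts = _ ∷ ts} (there s⊑ts) (num ∷ nums) u∈ s≼u =
    root≼⇒∈subtreeF s⊑ts nums
      (∈-tail {ts = ts} num u∈ (≤-trans (pre≥ (windowF nums (root∈subtreeF s⊑ts))) (pre-≤ s≼u))) s≼u

  private
    lcpFold : Tree (Info A) → List ℕ → List (Info A) → List ℕ
    lcpFold Tr = foldr (λ w acc → lcp {A} (pathT Tr (pre w)) acc)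

  ∈-lcp⁻ʳ : ∀ {x} (P Q : List ℕ) → x ∈ lcp {A} P Q → x ∈ Q
  ∈-lcp⁻ʳ (a ∷ P) (b ∷ Q) x∈ with a ≡ᵇ b in a≡ᵇb
  ∈-lcp⁻ʳ (a ∷ P) (b ∷ Q) (here refl) | true = here (≡ᵇ-true⇒≡ a≡ᵇb)
  ∈-lcp⁻ʳ (a ∷ P) (b ∷ Q) (there x∈)  | true = there (∈-lcp⁻ʳ P Q x∈)

  lcp-++ : (P r₁ r₂ : List ℕ) → lcp {A} (P ++ r₁) (P ++ r₂) ≡ P ++ lcp {A} r₁ r₂
  lcp-++ []      r₁ r₂ = refl
  lcp-++ (a ∷ P) r₁ r₂ with a ≡ᵇ a in a≡ᵇa
  ... | true  = cong (a ∷_) (lcp-++ P r₁ r₂)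
  ... | false = ⊥-elim (≡ᵇ-false⇒≢ {a} a≡ᵇa refl)

  ∈-lcpFold⁻ : ∀ {x} Tr init vs → x ∈ lcpFold Tr init vs → x ∈ init
  ∈-lcpFold⁻ Tr init []       x∈ = x∈
  ∈-lcpFold⁻ Tr init (w ∷ vs) x∈ = ∈-lcpFold⁻ Tr init vs (∈-lcp⁻ʳ (pathT Tr (pre w)) _ x∈)

  lcpFold-prefix : ∀ Tr P init vs → ∃[ r ] init ≡ P ++ r →
    (∀ {w} → w ∈ vs → ∃[ r ] pathT Tr (pre w) ≡ P ++ r) → ∃[ r ] lcpFold Tr init vs ≡ P ++ r
  lcpFold-prefix Tr P init []       init≡ _      = init≡
  lcpFold-prefix Tr P init (w ∷ vs) init≡ paths≡
    with lcpFold-prefix Tr P init vs init≡ (paths≡ ∘ there) | paths≡ (here refl)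
  ... | r , acc≡ | r′ , path≡ = lcp {A} r′ r , trans (cong₂ (lcp {A}) path≡ acc≡) (lcp-++ P r′ r)

  ∈-dropLastIfIn⁻ : ∀ {x} (G : Forest (Info A)) L → x ∈ dropLastIfIn G L → x ∈ L
  ∈-dropLastIfIn⁻ G (a ∷ []) x∈ with inForest a G
  ∈-dropLastIfIn⁻ G (a ∷ []) (here refl) | false = here refl
  ∈-dropLastIfIn⁻ G (a ∷ b ∷ L) (here refl) = here refl
  ∈-dropLastIfIn⁻ G (a ∷ b ∷ L) (there x∈)  = there (∈-dropLastIfIn⁻ G (b ∷ L) x∈)

  ∈-dropLastIfIn⁺ : ∀ {x} (G : Forest (Info A)) L → x ∈ L → ¬ T (inForest x G) → x ∈ dropLastIfIn G L
  ∈-dropLastIfIn⁺ G (a ∷ []) (here refl) x∉G with inForest a G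
  ... | true  = ⊥-elim (x∉G _)
  ... | false = here refl
  ∈-dropLastIfIn⁺ G (a ∷ b ∷ L) (here refl) _   = here refl
  ∈-dropLastIfIn⁺ G (a ∷ b ∷ L) (there x∈)  x∉G = there (∈-dropLastIfIn⁺ G (b ∷ L) x∈ x∉G)

  MU⊆path : ∀ {x} Tr i cs ts → x ∈ MU Tr (node i cs ∷ ts) → x ∈ pathT Tr (pre i)
  MU⊆path Tr i cs ts x∈ =
    ∈-lcpFold⁻ Tr _ (nodesF cs ++ nodesF ts)
      (∈-dropLastIfIn⁻ (node i cs ∷ ts) (pathToLCA Tr (node i cs ∷ ts)) x∈)

  common-ancestor∈MU : ∀ {Tr p q u} i cs ts → NumberedT Tr p q → u ∈ nodesT Tr →
    (∀ {w} → w ∈ nodesF (node i cs ∷ ts) → w ∈ nodesT Tr × u ≼ w) →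
    ¬ T (inForest (pre u) (node i cs ∷ ts)) → pre u ∈ MU Tr (node i cs ∷ ts)
  common-ancestor∈MU {Tr} {u = u} i cs ts num u∈ below-u u∉G =
    ∈-dropLastIfIn⁺ (node i cs ∷ ts) (pathToLCA Tr (node i cs ∷ ts)) u∈lca u∉G
    where
      prefix : ∀ {w} → w ∈ nodesF (node i cs ∷ ts) → ∃[ r ] pathT Tr (pre w) ≡ pathT Tr (pre u) ++ r
      prefix w∈ = ≼⇒pathT-prefix num u∈ (proj₁ (below-u w∈)) (proj₂ (below-u w∈))
      u∈lca : pre u ∈ pathToLCA Tr (node i cs ∷ ts)
      u∈lca with lcpFold-prefix Tr (pathT Tr (pre u)) (pathT Tr (pre i)) (nodesF cs ++ nodesF ts)
                   (prefix (here refl)) (prefix ∘ there)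
      ... | r , lca≡ = subst (pre u ∈_) (sym lca≡) (∈-++⁺ˡ (pre∈pathT num u∈))

  memℕ⁻ : ∀ {x xs} → T (memℕ {A} x xs) → x ∈ xs
  memℕ⁻ {x} {xs} x∈ = Any.map (≡ᵇ⇒≡ x _) (any⁻ _ xs x∈)

  memℕ⁺ : ∀ {x xs} → x ∈ xs → T (memℕ {A} x xs)
  memℕ⁺ {x} x∈ = any⁺ _ (Any.map (≡⇒≡ᵇ x _) x∈)

  ∉forest : ∀ {x} {G : Forest (Info A)} → (∀ {w} → w ∈ nodesF G → x < pre w) → ¬ T (inForest x G)
  ∉forest {x} {G} x<G x∈G with find (any⁻ _ (nodesF G) x∈G)
  ... | w , w∈G , x≡ᵇw = <-irrefl (≡ᵇ⇒≡ x (pre w) x≡ᵇw) (x<G w∈G)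

module _ {A : Set} {Tr : Tree (Info A)} (numTr : NumberedT Tr 0 0) where

  data Chain : Forest (Info A) → ℕ → ℕ → ℕ → ℕ → Set where
    end  : ∀ {pa pb ea eb} → pa ≤ ea → pb ≤ eb → Chain [] pa pb ea eb
    cons : ∀ {t ts p q pa pb ea eb} → Subtree t Tr → NumberedT t p q → pa ≤ p → pb ≤ q →
           Chain ts (p + sizeT t) (q + sizeT t) ea eb → Chain (t ∷ ts) pa pb ea eb

  chain-size : ∀ {G pa pb ea eb} → Chain G pa pb ea eb → pa + sizeF G ≤ ea × pb + sizeF G ≤ eb
  chain-size {pa = pa} {pb} (end pa≤ea pb≤eb) =
    ≤-trans (≤-reflexive (+-identityʳ pa)) pa≤ea , ≤-trans (≤-reflexive (+-identityʳ pb)) pb≤eb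
  chain-size {t ∷ ts} {pa} {pb} (cons _ _ pa≤p pb≤q rest) with chain-size rest
  ... | pre-end , post-end =
    shift pa≤p pre-end , shift pb≤q post-end
    where
      shift : ∀ {a b e} → a ≤ b → b + sizeT t + sizeF ts ≤ e → a + (sizeT t + sizeF ts) ≤ e
      shift {a} a≤b le = ≤-trans (≤-reflexive (sym (+-assoc a (sizeT t) (sizeF ts))))
                                 (≤-trans (+-monoˡ-≤ _ (+-monoˡ-≤ _ a≤b)) le)

  chain-weakenˡ : ∀ {G pa pb ea eb pa′ pb′} → pa′ ≤ pa → pb′ ≤ pb →
    Chain G pa pb ea eb → Chain G pa′ pb′ ea eb
  chain-weakenˡ a b (end c d)              = end (≤-trans a c) (≤-trans b d)
  chain-weakenˡ a b (cons st num c d rest) = cons st num (≤-trans a c) (≤-trans b d) rest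

  chain-weakenʳ : ∀ {G pa pb ea eb ea′ eb′} → ea ≤ ea′ → eb ≤ eb′ →
    Chain G pa pb ea eb → Chain G pa pb ea′ eb′
  chain-weakenʳ a b (end c d)              = end (≤-trans c a) (≤-trans d b)
  chain-weakenʳ a b (cons st num c d rest) = cons st num c d (chain-weakenʳ a b rest)

  chain-++ : ∀ {xs ys pa pb pm qm ea eb} → Chain xs pa pb pm qm → Chain ys pm qm ea eb →
    Chain (xs ++ ys) pa pb ea eb
  chain-++ (end a b)              ys-chain = chain-weakenˡ a b ys-chain
  chain-++ (cons st num a b rest) ys-chain = cons st num a b (chain-++ rest ys-chain)

  numbered-chain : ∀ {ts p q} → NumberedF ts p q → (∀ {t} → t ∈ ts → Subtree t Tr) →
    Chain ts p q (p + sizeF ts) (q + sizeF ts)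
  numbered-chain {p = p} {q} [] _ = end (m≤m+n p 0) (m≤m+n q 0)
  numbered-chain {t ∷ ts} {p} {q} (num ∷ nums) subtrees =
    cons (subtrees (here refl)) num ≤-refl ≤-refl
      (subst₂ (Chain ts (p + sizeT t) (q + sizeT t)) (+-assoc p _ _) (+-assoc q _ _)
        (numbered-chain nums (subtrees ∘ there)))

  children-chain : ∀ {i cs p q} → Subtree (node i cs) Tr → NumberedT (node i cs) p q →
    Chain cs (suc p) q (suc p + sizeF cs) (q + sizeF cs)
  children-chain st (node nums) = numbered-chain nums (children-Subtree st)

  descendant-in-window : ∀ {G pa pb ea eb u v} → Chain G pa pb ea eb → u ∈ nodesT Tr →
    v ∈ nodesF G → v ≼ u → InWindow u pa pb ea eb
  descendant-in-window {t ∷ ts} (cons st num pa≤p pb≤q rest) u∈ v∈ v≼u with ∈-++⁻ (nodesT t) v∈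
  ... | inj₁ v∈t =
    window-weaken pa≤p pb≤q (m+n≤o⇒m≤o _ (proj₁ (chain-size rest)))
                            (m+n≤o⇒m≤o _ (proj₂ (chain-size rest)))
      (windowT num (root≼⇒∈subtreeT st numTr u∈ (≼-trans (root-≼ num v∈t) v≼u)))
  ... | inj₂ v∈ts =
    window-weaken (≤-trans pa≤p (m≤m+n _ _)) (≤-trans pb≤q (m≤m+n _ _)) ≤-refl ≤-refl
      (descendant-in-window rest u∈ v∈ts v≼u)

  record LastTree (I : Forest (Info A)) (L : Tree (Info A)) (pa pb ea eb : ℕ) : Set where
    constructor lastTree
    field
      {pL qL}    : ℕ
      L-subtree  : Subtree L Tr
      L-numbered : NumberedT L pL qL
      init-chain : Chain I pa pb pL qL
      pre-end    : pL + sizeT L ≤ ea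
      post-end   : qL + sizeT L ≤ eb

  chain-last : ∀ I L {pa pb ea eb} → Chain (I ++ L ∷ []) pa pb ea eb → LastTree I L pa pb ea eb
  chain-last []      L (cons st num a b (end c d)) = lastTree st num (end a b) c d
  chain-last (_ ∷ I) L (cons st num a b rest) with chain-last I L rest
  ... | lastTree st′ num′ init c d = lastTree st′ num′ (cons st num a b init) c d

  -- length (LU Tr G) and length (RU Tr G) unfold to count (inLU G) and count (inRU G) over nodesT Tr.
  inLU inRU : Forest (Info A) → Info A → Bool
  inLU G u = not (memℕ {A} (pre u) (MU Tr G)) ∧ all (λ v → pre u <ᵇ pre v) (nodesF G)
  inRU G u = not (memℕ {A} (pre u) (MU Tr G)) ∧ all (λ v → post v <ᵇ post u) (nodesF G)

  module _ {i cs ts pa pb ea eb} (chain : Chain (node i cs ∷ ts) pa pb ea eb)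
           (nodes⊆ : nodesF (node i cs ∷ ts) ⊆ nodesT Tr) where

    private
      G = node i cs ∷ ts
      N = nodesT Tr
      n = sizeT Tr

      InMU : Info A → Set
      InMU u = T (memℕ {A} (pre u) (MU Tr G))

      i∈N : i ∈ N
      i∈N = lookup nodes⊆ (here refl)

      in-window : ∀ {w} → w ∈ nodesF G → InWindow w pa pb ea eb
      in-window w∈ = descendant-in-window chain (lookup nodes⊆ w∈) w∈ (≤-refl , ≤-refl)

      MU⇒≼i : ∀ {u} → u ∈ N → InMU u → u ≼ i
      MU⇒≼i u∈ u∈MU = pathT⇒≼ numTr u∈ i∈N (MU⊆path Tr i cs ts (memℕ⁻ {A} u∈MU))

      strict-ancestor⇒MU : ∀ {u} → u ∈ N → (∀ {w} → w ∈ nodesF G → pre u < pre w) →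
        (∀ {w} → w ∈ nodesF G → post w ≤ post u) → InMU u
      strict-ancestor⇒MU u∈ pre< post≥ = memℕ⁺ {A} (common-ancestor∈MU i cs ts numTr u∈
        (λ w∈ → lookup nodes⊆ w∈ , (<⇒≤ (pre< w∈) , post≥ w∈)) (∉forest {G = G} pre<))

      LU-intro : ∀ u → ¬ InMU u → (∀ {w} → w ∈ nodesF G → pre u < pre w) → T (inLU G u)
      LU-intro _ ∉MU before = T-not∧⁺ ∉MU (all⁻ _ (All.tabulate (<⇒<ᵇ ∘ before)))

      LU-elim : ∀ u → T (inLU G u) → ¬ InMU u × (∀ {w} → w ∈ nodesF G → pre u < pre w)
      LU-elim u u∈LU with T-not∧⁻ {memℕ {A} (pre u) (MU Tr G)} u∈LU
      ... | ∉MU , before = ∉MU , λ w∈ → <ᵇ⇒< _ _ (All.lookup (all⁺ _ (nodesF G) before) w∈)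

      RU-intro : ∀ u → ¬ InMU u → (∀ {w} → w ∈ nodesF G → post w < post u) → T (inRU G u)
      RU-intro _ ∉MU after = T-not∧⁺ ∉MU (all⁻ _ (All.tabulate (<⇒<ᵇ ∘ after)))

      RU-elim : ∀ u → T (inRU G u) → ¬ InMU u × (∀ {w} → w ∈ nodesF G → post w < post u)
      RU-elim u u∈RU with T-not∧⁻ {memℕ {A} (pre u) (MU Tr G)} u∈RU
      ... | ∉MU , after = ∉MU , λ w∈ → <ᵇ⇒< _ _ (All.lookup (all⁺ _ (nodesF G) after) w∈)

    pb≤LU : pb ≤ count (inLU G) N
    pb≤LU = begin
      pb                                 ≡⟨ m≤n⇒m⊓n≡m pb≤n ⟨
      pb ⊓ n                             ≡⟨ count-post<-T numTr pb ⟨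
      count (λ u → post u <ᵇ pb) N       ≤⟨ count-mono _ _ N (λ u∈ → post<pb⇒LU u∈ ∘ <ᵇ⇒< _ _) ⟩
      count (inLU G) N                   ∎
      where
        open ≤-Reasoning
        pb≤n = <⇒≤ (≤-<-trans (post≥ (in-window (here refl))) (post< (windowT numTr i∈N)))
        post<pb⇒LU : ∀ {u} → u ∈ N → post u < pb → T (inLU G u)
        post<pb⇒LU {u} u∈ u<pb = LU-intro u ∉MU before
          where
            ∉MU : ¬ InMU u
            ∉MU u∈MU = <⇒≱ u<pb (≤-trans (post≥ (in-window (here refl))) (post-≥ (MU⇒≼i u∈ u∈MU)))
            before : ∀ {w} → w ∈ nodesF G → pre u < pre w
            before {w} w∈ with pre u <? pre w
            ... | yes u<w = u<w
            ... | no  u≮w = ⊥-elim (<⇒≱ u<pb (post≥ (descendant-in-window chain u∈ w∈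
                                      (≮⇒≥ u≮w , <⇒≤ (<-≤-trans u<pb (post≥ (in-window w∈)))))))

    LU+G≤eb : count (inLU G) N + sizeF G ≤ eb
    LU+G≤eb = begin
      count (inLU G) N + sizeF G            ≡⟨ cong (count (inLU G) N +_) (length-nodesF G) ⟨
      count (inLU G) N + length (nodesF G)  ≤⟨ count+length≤count (inLU G) (λ u → post u <ᵇ eb) nodes⊆
                                                 (All.tabulate G-ok) (λ u∈ → <⇒<ᵇ ∘ LU⇒post<eb u∈) ⟩
      count (λ u → post u <ᵇ eb) N          ≡⟨ count-post<-T numTr eb ⟩
      eb ⊓ n                                ≤⟨ m⊓n≤m eb n ⟩
      eb                                    ∎
      where
        open ≤-Reasoning
        G-ok : ∀ {w} → w ∈ nodesF G → T (post w <ᵇ eb) × ¬ T (inLU G w)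
        G-ok {w} w∈ = <⇒<ᵇ (post< (in-window w∈)) , λ w∈LU → <-irrefl refl (proj₂ (LU-elim w w∈LU) w∈)
        LU⇒post<eb : ∀ {u} → u ∈ N → T (inLU G u) → post u < eb
        LU⇒post<eb {u} u∈ u∈LU with post u <? eb | LU-elim u u∈LU
        ... | yes u<eb | _             = u<eb
        ... | no  u≮eb | ∉MU , before  = ⊥-elim (∉MU (strict-ancestor⇒MU u∈ before
                                           (λ w∈ → <⇒≤ (<-≤-trans (post< (in-window w∈)) (≮⇒≥ u≮eb)))))

    n≤ea+RU : n ≤ ea + count (inRU G) N
    n≤ea+RU = begin
      n                                 ≡⟨ trans (count+count-not f N) (length-nodesT Tr) ⟨
      count f N + count (not ∘ f) N     ≤⟨ +-mono-≤ count-f≤ea (count-mono _ _ N pre≥ea⇒RU) ⟩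
      ea + count (inRU G) N             ∎
      where
        open ≤-Reasoning
        f = λ (u : Info A) → pre u <ᵇ ea
        count-f≤ea = ≤-trans (≤-reflexive (count-pre<-T numTr ea)) (m⊓n≤m ea n)
        pre≥ea⇒RU : ∀ {u} → u ∈ N → T (not (f u)) → T (inRU G u)
        pre≥ea⇒RU {u} u∈ u≮ᵇea = RU-intro u ∉MU after
          where
            ea≤u = ≮⇒≥ (T-not⁻ u≮ᵇea ∘ <⇒<ᵇ)
            ∉MU : ¬ InMU u
            ∉MU u∈MU = <⇒≱ (≤-<-trans (pre-≤ (MU⇒≼i u∈ u∈MU)) (pre< (in-window (here refl)))) ea≤u
            after : ∀ {w} → w ∈ nodesF G → post w < post u
            after {w} w∈ with post w <? post u
            ... | yes w<u = w<u
            ... | no  w≮u = ⊥-elim (<⇒≱ (pre< (descendant-in-window chain u∈ w∈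
                                      (<⇒≤ (<-≤-trans (pre< (in-window w∈)) ea≤u) , ≮⇒≥ w≮u))) ea≤u)

    pa+RU+G≤n : pa + (count (inRU G) N + sizeF G) ≤ n
    pa+RU+G≤n = begin
      pa + (count (inRU G) N + sizeF G)            ≡⟨ cong (λ s → pa + (count (inRU G) N + s))
                                                           (length-nodesF G) ⟨
      pa + (count (inRU G) N + length (nodesF G))  ≤⟨ +-monoʳ-≤ pa (count+length≤count (inRU G) (not ∘ f)
                                                        nodes⊆ (All.tabulate G-ok) RU⇒pre≥pa) ⟩
      pa + count (not ∘ f) N                       ≡⟨ cong (_+ count (not ∘ f) N) count-f ⟨
      count f N + count (not ∘ f) N                ≡⟨ trans (count+count-not f N) (length-nodesT Tr) ⟩
      n                                            ∎
      where
        open ≤-Reasoning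
        f = λ (u : Info A) → pre u <ᵇ pa
        count-f : count f N ≡ pa
        count-f = trans (count-pre<-T numTr pa)
          (m≤n⇒m⊓n≡m (<⇒≤ (≤-<-trans (pre≥ (in-window (here refl))) (pre< (windowT numTr i∈N)))))
        G-ok : ∀ {w} → w ∈ nodesF G → T (not (f w)) × ¬ T (inRU G w)
        G-ok {w} w∈ = T-not⁺ (λ w<ᵇpa → <⇒≱ (<ᵇ⇒< _ _ w<ᵇpa) (pre≥ (in-window w∈))) ,
                      λ w∈RU → <-irrefl refl (proj₂ (RU-elim w w∈RU) w∈)
        RU⇒pre≥pa : ∀ {u} → u ∈ N → T (inRU G u) → T (not (f u))
        RU⇒pre≥pa {u} u∈ u∈RU with RU-elim u u∈RU
        ... | ∉MU , after = T-not⁺ λ u<ᵇpa → ∉MU (strict-ancestor⇒MU u∈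
                              (λ w∈ → <-≤-trans (<ᵇ⇒< _ _ u<ᵇpa) (pre≥ (in-window w∈))) (<⇒≤ ∘ after))

  record Invariant (G : Forest (Info A)) (l dl r dr : ℕ) : Set where
    constructor invariant
    field
      {pa pb ea eb} : ℕ
      chain  : Chain G pa pb ea eb
      nodes⊆ : nodesF G ⊆ nodesT Tr
      l≤pb   : l ≤ pb
      eb≤    : eb ≤ l + dl + sizeF G
      ea+r≤n : ea + r ≤ sizeT Tr
      n≤     : sizeT Tr ≤ pa + (r + dr + sizeF G)

  Invariant⇒bounds : ∀ {G l dl r dr} → G ≢ [] → Invariant G l dl r dr →
    (l ≤ length (LU Tr G) × length (LU Tr G) ≤ l + dl) ×
    (r ≤ length (RU Tr G) × length (RU Tr G) ≤ r + dr)
  Invariant⇒bounds {[]} G≢[] _ = ⊥-elim (G≢[] refl)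
  Invariant⇒bounds {node i cs ∷ ts} {l} {dl} {r} {dr} _
    (invariant {pa} {pb} {ea} {eb} chain nodes⊆ l≤pb eb≤ ea+r≤n n≤) =
    (≤-trans l≤pb (pb≤LU chain nodes⊆) ,
     +-cancelʳ-≤ s _ _ (≤-trans (LU+G≤eb chain nodes⊆) eb≤)) ,
    (+-cancelˡ-≤ ea _ _ (≤-trans ea+r≤n (n≤ea+RU chain nodes⊆)) ,
     +-cancelʳ-≤ s _ _ (+-cancelˡ-≤ pa _ _ (≤-trans (pa+RU+G≤n chain nodes⊆) n≤)))
    where s = sizeF (node i cs ∷ ts)

  Invariant-initial : Invariant (Tr ∷ []) 0 0 0 0
  Invariant-initial = invariant (cons self numTr z≤n z≤n (end ≤-refl ≤-refl))
    (⊆-reflexive (++-identityʳ (nodesT Tr)))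
    z≤n (≤-reflexive (sym (+-identityʳ _))) (≤-reflexive (+-identityʳ _))
    (≤-reflexive (sym (+-identityʳ _)))

  deleteRootˡ : ∀ {i cs ts l dl r dr} → Invariant (node i cs ∷ ts) l dl r dr →
    Invariant (cs ++ ts) l (suc dl) r dr
  deleteRootˡ {i} {cs} {ts} {l} {dl} {r} {dr}
    (invariant {pa} {eb = eb} (cons {p = p} {q} st num pa≤p pb≤q rest) nodes⊆ l≤pb eb≤ ea+r≤n n≤) =
    invariant chain′ (subst (_⊆ nodesT Tr) (sym (nodesF-++ cs ts)) (∷ˡ⁻ nodes⊆))
      (≤-trans l≤pb pb≤q) eb≤′ ea+r≤n n≤′
    where
      open ≤-Reasoning
      s₁ = sizeF cs
      s₂ = sizeF ts
      chain′ : Chain (cs ++ ts) (suc p) q _ eb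
      chain′ = chain-++ (children-chain st num)
                 (chain-weakenˡ (≤-reflexive (sym (+-suc p s₁))) (+-monoʳ-≤ q (n≤1+n s₁)) rest)
      eb≤′ : eb ≤ l + suc dl + sizeF (cs ++ ts)
      eb≤′ = begin
        eb                              ≤⟨ eb≤ ⟩
        l + dl + suc (s₁ + s₂)          ≡⟨ regroup l dl (s₁ + s₂) ⟩
        l + suc dl + (s₁ + s₂)          ≡⟨ cong (l + suc dl +_) (sizeF-++ cs ts) ⟨
        l + suc dl + sizeF (cs ++ ts)   ∎
        where regroup : ∀ a b c → a + b + suc c ≡ a + suc b + c
              regroup = solve-∀
      n≤′ : sizeT Tr ≤ suc p + (r + dr + sizeF (cs ++ ts))
      n≤′ = begin
        sizeT Tr                              ≤⟨ n≤ ⟩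
        pa + (r + dr + suc (s₁ + s₂))         ≤⟨ +-monoˡ-≤ _ pa≤p ⟩
        p + (r + dr + suc (s₁ + s₂))          ≡⟨ regroup p (r + dr) (s₁ + s₂) ⟩
        suc p + (r + dr + (s₁ + s₂))          ≡⟨ cong (λ s → suc p + (r + dr + s)) (sizeF-++ cs ts) ⟨
        suc p + (r + dr + sizeF (cs ++ ts))   ∎
        where regroup : ∀ a b c → a + (b + suc c) ≡ suc a + (b + c)
              regroup = solve-∀

  dropTreeˡ : ∀ {t ts l dl r dr} → Invariant (t ∷ ts) l dl r dr → Invariant ts (l + sizeT t) dl r dr
  dropTreeˡ {t} {ts} {l} {dl} {r} {dr}
    (invariant {pa} (cons {p = p} {q} _ _ pa≤p pb≤q rest) nodes⊆ l≤pb eb≤ ea+r≤n n≤) =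
    invariant rest (⊆-trans (++⁺ˡ (nodesT t) ⊆-refl) nodes⊆) (+-monoˡ-≤ (sizeT t) (≤-trans l≤pb pb≤q))
      (≤-trans eb≤ (≤-reflexive (regroup l dl (sizeT t) (sizeF ts))))
      ea+r≤n
      (≤-trans n≤ (≤-trans (+-monoˡ-≤ _ pa≤p) (≤-reflexive (regroup′ p (r + dr) (sizeT t) (sizeF ts)))))
    where
      regroup : ∀ a b c d → a + b + (c + d) ≡ a + c + b + d
      regroup = solve-∀
      regroup′ : ∀ a b c d → a + (b + (c + d)) ≡ a + c + (b + d)
      regroup′ = solve-∀

  descendˡ : ∀ {i cs ts l dl r dr} → Invariant (node i cs ∷ ts) l dl r dr →
    Invariant cs l dl (r + sizeF ts) dr
  descendˡ {i} {cs} {ts} {l} {dl} {r} {dr}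
    (invariant {pa} {ea = ea} (cons {p = p} {q} st num pa≤p pb≤q rest) nodes⊆ l≤pb eb≤ ea+r≤n n≤) =
    invariant (children-chain st num) (⊆-trans (++⁺ʳ (nodesF ts) ⊆-refl) (∷ˡ⁻ nodes⊆))
      (≤-trans l≤pb pb≤q) (+-monoˡ-≤ s₁ q≤l+dl) ea′+r′≤n n≤′
    where
      open ≤-Reasoning
      s₁ = sizeF cs
      s₂ = sizeF ts
      q≤l+dl : q ≤ l + dl
      q≤l+dl = +-cancelʳ-≤ (suc (s₁ + s₂)) q (l + dl) (begin
        q + suc (s₁ + s₂)    ≡⟨ +-assoc q (suc s₁) s₂ ⟨
        q + suc s₁ + s₂      ≤⟨ proj₂ (chain-size rest) ⟩
        _                    ≤⟨ eb≤ ⟩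
        l + dl + suc (s₁ + s₂) ∎)
      ea′+r′≤n : suc p + s₁ + (r + s₂) ≤ sizeT Tr
      ea′+r′≤n = begin
        suc p + s₁ + (r + s₂)  ≡⟨ regroup p s₁ s₂ r ⟩
        p + suc s₁ + s₂ + r    ≤⟨ +-monoˡ-≤ r (proj₁ (chain-size rest)) ⟩
        ea + r                 ≤⟨ ea+r≤n ⟩
        sizeT Tr               ∎
        where regroup : ∀ a b c d → suc a + b + (d + c) ≡ a + suc b + c + d
              regroup = solve-∀
      n≤′ : sizeT Tr ≤ suc p + (r + s₂ + dr + s₁)
      n≤′ = begin
        sizeT Tr                        ≤⟨ n≤ ⟩
        pa + (r + dr + suc (s₁ + s₂))   ≤⟨ +-monoˡ-≤ _ pa≤p ⟩
        p + (r + dr + suc (s₁ + s₂))    ≡⟨ regroup p r dr s₁ s₂ ⟩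
        suc p + (r + s₂ + dr + s₁)      ∎
        where regroup : ∀ a b c d e → a + (b + c + suc (d + e)) ≡ suc a + (b + e + c + d)
              regroup = solve-∀

  record LastView (I : Forest (Info A)) (L : Tree (Info A)) (l dl r dr : ℕ) : Set where
    constructor lastView
    field
      {pa pb pL qL} : ℕ
      L-subtree  : Subtree L Tr
      L-numbered : NumberedT L pL qL
      init-chain : Chain I pa pb pL qL
      nodes⊆     : nodesF I ++ nodesT L ⊆ nodesT Tr
      l≤pb       : l ≤ pb
      qL≤        : qL ≤ l + dl + sizeF I
      pL+r≤n     : pL + sizeT L + r ≤ sizeT Tr
      n≤         : sizeT Tr ≤ pa + (r + dr + (sizeF I + sizeT L))

  Invariant-lastView : ∀ {I L l dl r dr} → Invariant (I ++ L ∷ []) l dl r dr →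
    LastView I L l dl r dr
  Invariant-lastView {I} {L} {l} {dl} {r} {dr} (invariant {pa} chain nodes⊆ l≤pb eb≤ ea+r≤n n≤)
    with chain-last I L chain
  ... | lastTree {pL} {qL} st num init pre-end post-end =
    lastView st num init
      (subst (_⊆ nodesT Tr) (trans (nodesF-++ I (L ∷ [])) (cong (nodesF I ++_) (++-identityʳ _)))
             nodes⊆)
      l≤pb
      (+-cancelʳ-≤ (sizeT L) qL (l + dl + sizeF I) (begin
        qL + sizeT L                        ≤⟨ post-end ⟩
        _                                   ≤⟨ eb≤ ⟩
        l + dl + sizeF (I ++ L ∷ [])        ≡⟨ cong (l + dl +_) size≡ ⟩
        l + dl + (sizeF I + sizeT L)        ≡⟨ +-assoc (l + dl) (sizeF I) (sizeT L) ⟨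
        l + dl + sizeF I + sizeT L          ∎))
      (≤-trans (+-monoˡ-≤ r pre-end) ea+r≤n)
      (≤-trans n≤ (≤-reflexive (cong (λ s → pa + (r + dr + s)) size≡)))
    where
      open ≤-Reasoning
      size≡ : sizeF (I ++ L ∷ []) ≡ sizeF I + sizeT L
      size≡ = trans (sizeF-++ I (L ∷ [])) (cong (sizeF I +_) (+-identityʳ (sizeT L)))

  private
    deleteRootʳ′ : ∀ {I L l dl r dr} → Invariant (I ++ L ∷ []) l dl r dr →
      Invariant (I ++ children L) l dl r (suc dr)
    deleteRootʳ′ {I} {node j cs} {l} {dl} {r} {dr} inv with Invariant-lastView inv
    ... | lastView {pa} {pL = pL} {qL} st num init nodes⊆ l≤pb qL≤ pL+r≤n n≤ =
      invariant
        (chain-++ (chain-weakenʳ (n≤1+n pL) ≤-refl init) (children-chain st num))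
        (subst (_⊆ nodesT Tr) (sym (nodesF-++ I cs)) (⊆-trans (++⁺ ⊆-refl (j ∷ʳ ⊆-refl)) nodes⊆))
        l≤pb eb≤′ (≤-trans (≤-reflexive (cong (_+ r) (sym (+-suc pL s)))) pL+r≤n) n≤′
      where
        open ≤-Reasoning
        s = sizeF cs
        eb≤′ : qL + s ≤ l + dl + sizeF (I ++ cs)
        eb≤′ = begin
          qL + s                        ≤⟨ +-monoˡ-≤ s qL≤ ⟩
          l + dl + sizeF I + s          ≡⟨ +-assoc (l + dl) (sizeF I) s ⟩
          l + dl + (sizeF I + s)        ≡⟨ cong (l + dl +_) (sizeF-++ I cs) ⟨
          l + dl + sizeF (I ++ cs)      ∎
        n≤′ : sizeT Tr ≤ pa + (r + suc dr + sizeF (I ++ cs))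
        n≤′ = begin
          sizeT Tr                              ≤⟨ n≤ ⟩
          pa + (r + dr + (sizeF I + suc s))     ≡⟨ regroup pa r dr (sizeF I) s ⟩
          pa + (r + suc dr + (sizeF I + s))     ≡⟨ cong (λ x → pa + (r + suc dr + x)) (sizeF-++ I cs) ⟨
          pa + (r + suc dr + sizeF (I ++ cs))   ∎
          where regroup : ∀ a b c d e → a + (b + c + (d + suc e)) ≡ a + (b + suc c + (d + e))
                regroup = solve-∀

    dropTreeʳ′ : ∀ {I L l dl r dr} → Invariant (I ++ L ∷ []) l dl r dr →
      Invariant I l dl (r + sizeT L) dr
    dropTreeʳ′ {I} {L} {l} {dl} {r} {dr} inv with Invariant-lastView inv
    ... | lastView {pa} {pL = pL} st num init nodes⊆ l≤pb qL≤ pL+r≤n n≤ =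
      invariant init (⊆-trans (++⁺ʳ (nodesT L) ⊆-refl) nodes⊆) l≤pb qL≤
        (≤-trans (≤-reflexive (regroup pL r (sizeT L))) pL+r≤n)
        (≤-trans n≤ (≤-reflexive (regroup′ pa r dr (sizeF I) (sizeT L))))
      where
        regroup : ∀ a b c → a + (b + c) ≡ a + c + b
        regroup = solve-∀
        regroup′ : ∀ a b c d e → a + (b + c + (d + e)) ≡ a + (b + e + c + d)
        regroup′ = solve-∀

    descendʳ′ : ∀ {I L l dl r dr} → Invariant (I ++ L ∷ []) l dl r dr →
      Invariant (children L) (l + sizeF I) dl r dr
    descendʳ′ {I} {node j cs} {l} {dl} {r} {dr} inv with Invariant-lastView inv
    ... | lastView {pa} {pb} {pL} {qL} st num init nodes⊆ l≤pb qL≤ pL+r≤n n≤ =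
      invariant (children-chain st num)
        (⊆-trans (++⁺ˡ (nodesF I) (j ∷ʳ ⊆-refl)) nodes⊆)
        (≤-trans (+-monoˡ-≤ (sizeF I) l≤pb) (proj₂ (chain-size init)))
        (≤-trans (+-monoˡ-≤ s qL≤) (≤-reflexive (regroup l dl (sizeF I) s)))
        (≤-trans (≤-reflexive (cong (_+ r) (sym (+-suc pL s)))) pL+r≤n)
        n≤′
      where
        open ≤-Reasoning
        s = sizeF cs
        regroup : ∀ a b c d → a + b + c + d ≡ a + c + b + d
        regroup = solve-∀
        n≤′ : sizeT Tr ≤ suc pL + (r + dr + s)
        n≤′ = begin
          sizeT Tr                            ≤⟨ n≤ ⟩
          pa + (r + dr + (sizeF I + suc s))   ≡⟨ regroup′ pa r dr (sizeF I) s ⟩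
          pa + sizeF I + suc (r + dr + s)     ≤⟨ +-monoˡ-≤ _ (proj₁ (chain-size init)) ⟩
          pL + suc (r + dr + s)               ≡⟨ +-suc pL _ ⟩
          suc pL + (r + dr + s)               ∎
          where regroup′ : ∀ a b c d e → a + (b + c + (d + suc e)) ≡ a + d + suc (b + c + e)
                regroup′ = solve-∀

  deleteRootʳ : ∀ {t ts l dl r dr} → Invariant (t ∷ ts) l dl r dr →
    Invariant (initT t ts ++ children (lastT t ts)) l dl r (suc dr)
  deleteRootʳ {t} {ts} = deleteRootʳ′ ∘ subst (λ G → Invariant G _ _ _ _) (init-last t ts)

  dropTreeʳ : ∀ {t ts l dl r dr} → Invariant (t ∷ ts) l dl r dr →
    Invariant (initT t ts) l dl (r + sizeT (lastT t ts)) dr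
  dropTreeʳ {t} {ts} = dropTreeʳ′ ∘ subst (λ G → Invariant G _ _ _ _) (init-last t ts)

  descendʳ : ∀ {t ts l dl r dr} → Invariant (t ∷ ts) l dl r dr →
    Invariant (children (lastT t ts)) (l + sizeF (initT t ts)) dl r dr
  descendʳ {t} {ts} = descendʳ′ ∘ subst (λ G → Invariant G _ _ _ _) (init-last t ts)

∣+-+∣≤ : ∀ a b x y → ∣ a + x - b + y ∣ ≤ ∣ a - b ∣ + ∣ x - y ∣
∣+-+∣≤ a b x y = begin
  ∣ a + x - b + y ∣                     ≤⟨ ∣-∣-triangle (a + x) (b + x) (b + y) ⟩
  ∣ a + x - b + x ∣ + ∣ b + x - b + y ∣ ≡⟨ cong₂ (λ u v → ∣ u - v ∣ + ∣ b + x - b + y ∣)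
                                                (+-comm a x) (+-comm b x) ⟩
  ∣ x + a - x + b ∣ + ∣ b + x - b + y ∣ ≡⟨ cong₂ _+_ (∣m+n-m+o∣≡∣n-o∣ x a b) (∣m+n-m+o∣≡∣n-o∣ b x y) ⟩
  ∣ a - b ∣ + ∣ x - y ∣                 ∎
  where open ≤-Reasoning

∣-∣≤slack : ∀ {a x d} → a ≤ x → x ≤ a + d → ∣ x - a ∣ ≤ d
∣-∣≤slack {a} {x} a≤x x≤a+d = ≤-trans (≤-reflexive (m≤n⇒∣n-m∣≡n∸m a≤x)) (m≤n+o⇒m∸n≤o x a x≤a+d)

∣-∣≤sandwich : ∀ {l₁ l₂ x y d₁ d₂} → l₁ ≤ x → x ≤ l₁ + d₁ → l₂ ≤ y → y ≤ l₂ + d₂ →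
  ∣ x - y ∣ ≤ ∣ l₁ - l₂ ∣ + d₁ + d₂
∣-∣≤sandwich {l₁} {l₂} {x} {y} {d₁} {d₂} l₁≤x x≤ l₂≤y y≤ = begin
  ∣ x - y ∣                                 ≤⟨ ∣-∣-triangle x l₁ y ⟩
  ∣ x - l₁ ∣ + ∣ l₁ - y ∣                   ≤⟨ +-monoʳ-≤ ∣ x - l₁ ∣ (∣-∣-triangle l₁ l₂ y) ⟩
  ∣ x - l₁ ∣ + (∣ l₁ - l₂ ∣ + ∣ l₂ - y ∣)   ≡⟨ cong (λ z → ∣ x - l₁ ∣ + (∣ l₁ - l₂ ∣ + z)) (∣-∣-comm l₂ y) ⟩
  ∣ x - l₁ ∣ + (∣ l₁ - l₂ ∣ + ∣ y - l₂ ∣)   ≤⟨ +-mono-≤ (∣-∣≤slack l₁≤x x≤)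
                                                        (+-monoʳ-≤ ∣ l₁ - l₂ ∣ (∣-∣≤slack l₂≤y y≤)) ⟩
  d₁ + (∣ l₁ - l₂ ∣ + d₂)                   ≡⟨ regroup d₁ ∣ l₁ - l₂ ∣ d₂ ⟩
  ∣ l₁ - l₂ ∣ + d₁ + d₂                     ∎
  where
    open ≤-Reasoning
    regroup : ∀ a b c → a + (b + c) ≡ b + a + c
    regroup = solve-∀

module _ {A : Set} {T₁ T₂ : Tree (Info A)} (num₁ : NumberedT T₁ 0 0) (num₂ : NumberedT T₂ 0 0) where

  record Tracked (s : State {Info A}) (c : ℕ) : Set where
    constructor tracked
    field
      {l₁ dl₁ r₁ dr₁ l₂ dl₂ r₂ dr₂} : ℕ
      inv₁ : Invariant num₁ (proj₁ s) l₁ dl₁ r₁ dr₁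
      inv₂ : Invariant num₂ (proj₂ s) l₂ dl₂ r₂ dr₂
      left-cost  : ∣ l₁ - l₂ ∣ + dl₁ + dl₂ ≤ c
      right-cost : ∣ r₁ - r₂ ∣ + dr₁ + dr₂ ≤ c

  private
    slack-suc₁ : ∀ e {d₁ d₂ c} → e + d₁ + d₂ ≤ c → e + suc d₁ + d₂ ≤ c + 1
    slack-suc₁ e {d₁} {d₂} {c} le = ≤-trans (≤-reflexive (shift e d₁ d₂)) (+-monoˡ-≤ 1 le)
      where shift : ∀ e d₁ d₂ → e + suc d₁ + d₂ ≡ e + d₁ + d₂ + 1
            shift = solve-∀

    slack-suc₂ : ∀ e {d₁ d₂ c} → e + d₁ + d₂ ≤ c → e + d₁ + suc d₂ ≤ c + 1
    slack-suc₂ e {d₁} {d₂} {c} le = ≤-trans (≤-reflexive (shift e d₁ d₂)) (+-monoˡ-≤ 1 le)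
      where shift : ∀ e d₁ d₂ → e + d₁ + suc d₂ ≡ e + d₁ + d₂ + 1
            shift = solve-∀

    shift-cost : ∀ a b {d₁ d₂ c} x y → ∣ a - b ∣ + d₁ + d₂ ≤ c →
      ∣ a + x - b + y ∣ + d₁ + d₂ ≤ c + ∣ x - y ∣
    shift-cost a b {d₁} {d₂} {c} x y le = begin
      ∣ a + x - b + y ∣ + d₁ + d₂             ≤⟨ +-monoˡ-≤ d₂ (+-monoˡ-≤ d₁ (∣+-+∣≤ a b x y)) ⟩
      ∣ a - b ∣ + ∣ x - y ∣ + d₁ + d₂         ≡⟨ regroup ∣ a - b ∣ ∣ x - y ∣ d₁ d₂ ⟩
      ∣ a - b ∣ + d₁ + d₂ + ∣ x - y ∣         ≤⟨ +-monoˡ-≤ ∣ x - y ∣ le ⟩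
      c + ∣ x - y ∣                           ∎
      where open ≤-Reasoning
            regroup : ∀ e f d₁ d₂ → e + f + d₁ + d₂ ≡ e + d₁ + d₂ + f
            regroup = solve-∀

  Tracked-edge : ∀ {s s′ c c′} → Edge s s′ c′ → Tracked s c → Tracked s′ (c + c′)
  Tracked-edge (r-del₁ _ _ _ _ _) (tracked {r₁ = r₁} {r₂ = r₂} inv₁ inv₂ lc rc) =
    tracked (deleteRootʳ num₁ inv₁) inv₂ (m≤n⇒m≤n+o 1 lc) (slack-suc₁ ∣ r₁ - r₂ ∣ rc)
  Tracked-edge (r-del₂ _ _ _ _ _) (tracked {r₁ = r₁} {r₂ = r₂} inv₁ inv₂ lc rc) =
    tracked inv₁ (deleteRootʳ num₂ inv₂) (m≤n⇒m≤n+o 1 lc) (slack-suc₂ ∣ r₁ - r₂ ∣ rc)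
  Tracked-edge (r-rest t₁ ts₁ t₂ ts₂ _) (tracked {r₁ = r₁} {r₂ = r₂} inv₁ inv₂ lc rc) =
    tracked (dropTreeʳ num₁ inv₁) (dropTreeʳ num₂ inv₂) (m≤n⇒m≤n+o _ lc)
      (shift-cost r₁ r₂ (sizeT (lastT t₁ ts₁)) (sizeT (lastT t₂ ts₂)) rc)
  Tracked-edge (r-in t₁ ts₁ t₂ ts₂ _) (tracked {l₁} {l₂ = l₂} inv₁ inv₂ lc rc) =
    tracked (descendʳ num₁ inv₁) (descendʳ num₂ inv₂)
      (shift-cost l₁ l₂ (sizeF (initT t₁ ts₁)) (sizeF (initT t₂ ts₂)) lc) (m≤n⇒m≤n+o _ rc)
  Tracked-edge (l-del₁ (node _ _) _ _ _ _) (tracked {l₁} {l₂ = l₂} inv₁ inv₂ lc rc) =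
    tracked (deleteRootˡ num₁ inv₁) inv₂ (slack-suc₁ ∣ l₁ - l₂ ∣ lc) (m≤n⇒m≤n+o 1 rc)
  Tracked-edge (l-del₂ _ _ (node _ _) _ _) (tracked {l₁} {l₂ = l₂} inv₁ inv₂ lc rc) =
    tracked inv₁ (deleteRootˡ num₂ inv₂) (slack-suc₂ ∣ l₁ - l₂ ∣ lc) (m≤n⇒m≤n+o 1 rc)
  Tracked-edge (l-rest t₁ _ t₂ _ _) (tracked {l₁} {l₂ = l₂} inv₁ inv₂ lc rc) =
    tracked (dropTreeˡ num₁ inv₁) (dropTreeˡ num₂ inv₂) (shift-cost l₁ l₂ (sizeT t₁) (sizeT t₂) lc)
      (m≤n⇒m≤n+o _ rc)
  Tracked-edge (l-in (node _ _) ts₁ (node _ _) ts₂ _) (tracked {r₁ = r₁} {r₂ = r₂} inv₁ inv₂ lc rc) =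
    tracked (descendˡ num₁ inv₁) (descendˡ num₂ inv₂) (m≤n⇒m≤n+o _ lc)
      (shift-cost r₁ r₂ (sizeF ts₁) (sizeF ts₂) rc)

  Tracked-path : ∀ {s s′ c c′} → Path s s′ c′ → Tracked s c → Tracked s′ (c + c′)
  Tracked-path {c = c} (here _) tr = subst (Tracked _) (sym (+-identityʳ c)) tr
  Tracked-path {c = c} (there {c1 = c₁} {c₂} e p) tr =
    subst (Tracked _) (+-assoc c c₁ c₂) (Tracked-path p (Tracked-edge e tr))

  Tracked-initial : Tracked (T₁ ∷ [] , T₂ ∷ []) 0
  Tracked-initial = tracked (Invariant-initial num₁) (Invariant-initial num₂) z≤n z≤n

lemma12 : {A : Set} (T₁ T₂ : Tree A) (k : ℕ) →
    EdLe (T₁ ∷ []) (T₂ ∷ []) k →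
    (G₁ G₂ : Forest (Info A)) → G₁ ≢ [] → G₂ ≢ [] →
    (c : ℕ) → Path (annotate T₁ ∷ [] , annotate T₂ ∷ []) (G₁ , G₂) c → c ≤ k →
    (∣ length (LU (annotate T₁) G₁) - length (LU (annotate T₂) G₂) ∣ ≤ k)
    × (∣ length (RU (annotate T₁) G₁) - length (RU (annotate T₂) G₂) ∣ ≤ k)
lemma12 T₁ T₂ k _ G₁ G₂ G₁≢[] G₂≢[] c path c≤k
  with Tracked-path num₁ num₂ path (Tracked-initial num₁ num₂)
  where num₁ = annotate-numbered T₁
        num₂ = annotate-numbered T₂
... | tracked inv₁ inv₂ left-cost right-cost
  with Invariant⇒bounds _ G₁≢[] inv₁ | Invariant⇒bounds _ G₂≢[] inv₂
... | (l₁≤ , ≤l₁) , (r₁≤ , ≤r₁) | (l₂≤ , ≤l₂) , (r₂≤ , ≤r₂) =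
  ≤-trans (∣-∣≤sandwich l₁≤ ≤l₁ l₂≤ ≤l₂) (≤-trans left-cost c≤k) ,
  ≤-trans (∣-∣≤sandwich r₁≤ ≤r₁ r₂≤ ≤r₂) (≤-trans right-cost c≤k)
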